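{- Let $A\in\mathbb{Z}^{d\times n}$ have columns $\mathbf{a}_1,\dots,\mathbf{a}_n$, and assume the entries of $\mathbf{a}_n$ have no common divisor (greater than $1$). Let $A'$ be the matrix consisting of the first $n-1$ columns of $P_{\mathbf{a}_n}A$, and let $\phi:\mathbb{K}[x_1,\dots,x_n]\to\mathbb{K}[x_1,\dots,x_{n-1}]$ be the substitution homomorphism sending $x_n\mapsto1$ and $x_i\mapsto x_i$ for $i<n$. Then $I_{A'}=\phi(I_A)$.
   Context: For a matrix $M$ with $n$ columns, its toric ideal is $I_M=\langle x^u-x^v: u,v\in\mathbb{N}^n,\ Mu=Mv\rangle\subseteq\mathbb{K}[x_1,\dots,x_n]$, $\mathbb{K}$ a field. For nonzero $\mathbf{v}$, $P_{\mathbf{v}}=I-\frac{\mathbf{v}\mathbf{v}^\intercal}{\|\mathbf{v}\|^2}$. -}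

module Defs where

open import Level using (Level; _⊔_)
open import Algebra.Bundles using (CommutativeRing)
open import Data.Nat as ℕ using (ℕ; zero; suc)
open import Data.Integer as ℤ using (ℤ)
open import Data.Rational as ℚ using (ℚ; 0ℚ; 1ℚ)
open import Data.Rational.Base using (≢-nonZero)
open import Data.Fin using (Fin; inject₁; fromℕ)
open import Data.Vec as Vec using (Vec; lookup; init; zipWith; tabulate)
open import Data.Vec.Properties using (≡-dec)
open import Data.List as List using (List; []; _∷_; _++_; concatMap; foldr)
open import Data.List.Relation.Unary.All using (All)
open import Data.Product using (Σ; ∃; _×_; _,_)
open import Relation.Binary.PropositionalEquality using (_≡_; _≢_)
open import Relation.Nullary using (¬_; yes; no)

IsField : ∀ {c ℓ} → CommutativeRing c ℓ → Set (c ⊔ ℓ)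
IsField R = ¬ (0# ≈ 1#) × (∀ x → ¬ (x ≈ 0#) → ∃ λ y → x * y ≈ 1#)
  where open CommutativeRing R

Matrix : Set → ℕ → ℕ → Set
Matrix R d n = Fin d → Fin n → R

col : ∀ {R d n} → Matrix R d n → Fin n → Fin d → R
col M j i = M i j

ℤ→ℚ : ℤ → ℚ
ℤ→ℚ z = z ℚ./ 1

ℕ→ℚ : ℕ → ℚ
ℕ→ℚ k = ℤ→ℚ (ℤ.+ k)

sumℚ : ∀ {n} → (Fin n → ℚ) → ℚ
sumℚ {n} f = Vec.foldr _ ℚ._+_ 0ℚ (tabulate f)

sumℤ : ∀ {n} → (Fin n → ℤ) → ℤ
sumℤ {n} f = Vec.foldr _ ℤ._+_ (ℤ.+ 0) (tabulate f)

normSq : ∀ {d} → (Fin d → ℤ) → ℚ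
normSq v = sumℚ (λ i → ℤ→ℚ (v i) ℚ.* ℤ→ℚ (v i))

-- The projection matrix P_v = I - v vᵀ / ‖v‖² (d×d, rational entries).
-- For v = 0 the formula is undefined; we then (arbitrarily) return I.
-- This case never arises in the theorem (the hypothesis forces v ≠ 0).
δ : ∀ {d} → Fin d → Fin d → ℚ
δ i j with i Data.Fin.≟ j
... | yes _ = 1ℚ
... | no  _ = 0ℚ

P : ∀ {d} → (Fin d → ℤ) → Matrix ℚ d d
P v i j with normSq v ℚ.≟ 0ℚ
... | yes _ = δ i j
... | no v≢0 = δ i j ℚ.- ((ℤ→ℚ (v i) ℚ.* ℤ→ℚ (v j)) ℚ.÷ normSq v)
  where instance _ = ≢-nonZero v≢0

mulQZ : ∀ {d n} → Matrix ℚ d d → Matrix ℤ d n → Matrix ℚ d n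
mulQZ Q A i j = sumℚ (λ k → Q i k ℚ.* ℤ→ℚ (A k j))

mulVecℤ : ∀ {d n} → Matrix ℤ d n → Vec ℕ n → Fin d → ℤ
mulVecℤ M u i = sumℤ (λ j → M i j ℤ.* ℤ.+ (lookup u j))

mulVecℚ : ∀ {d n} → Matrix ℚ d n → Vec ℕ n → Fin d → ℚ
mulVecℚ M u i = sumℚ (λ j → M i j ℚ.* ℕ→ℚ (lookup u j))

NoCommonDivisor : ∀ {d} → (Fin d → ℤ) → Set
NoCommonDivisor v = ∀ (k : ℕ) → 1 ℕ.< k → ¬ (∀ i → ℤ.+ k Data.Integer.Divisibility.∣ v i)
  where import Data.Integer.Divisibility

-- A' : first n columns of P_{a_{n+1}} A, for A with n+1 columns
A′ : ∀ {d n} → Matrix ℤ d (suc n) → Matrix ℚ d n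
A′ {n = n} A i j = mulQZ (P (col A (fromℕ n))) A i (inject₁ j)

-- Polynomials over a commutative ring R in variables x_1..x_m,
-- represented as finite lists of terms (coefficient, exponent vector);
-- two polynomials are equal when all their coefficients agree.

module Poly {c ℓ} (R : CommutativeRing c ℓ) where
  open CommutativeRing R

  Term : ℕ → Set c
  Term m = Carrier × Vec ℕ m

  Pol : ℕ → Set c
  Pol m = List (Term m)

  coeff : ∀ {m} → Pol m → Vec ℕ m → Carrier
  coeff [] e = 0#
  coeff ((a , e′) ∷ p) e with ≡-dec ℕ._≟_ e′ e
  ... | yes _ = a + coeff p e
  ... | no  _ = coeff p e

  _≈P_ : ∀ {m} → Pol m → Pol m → Set ℓ
  p ≈P q = ∀ e → coeff p e ≈ coeff q e

  _+P_ : ∀ {m} → Pol m → Pol m → Pol m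
  _+P_ = _++_

  _*P_ : ∀ {m} → Pol m → Pol m → Pol m
  p *P q = concatMap (λ { (a , e) → List.map (λ { (b , f) → (a * b , zipWith ℕ._+_ e f) }) q }) p

  0P : ∀ {m} → Pol m
  0P = []

  sumP : ∀ {m} → List (Pol m) → Pol m
  sumP = foldr _+P_ 0P

  binom : ∀ {m} → Vec ℕ m → Vec ℕ m → Pol m
  binom u v = (1# , u) ∷ (- 1# , v) ∷ []

  -- Toric ideal of a matrix M (over any coefficient type B with
  -- propositional equality, here ℤ or ℚ): f ∈ I_M iff f is a finite
  -- combination Σ gᵢ (x^uᵢ - x^vᵢ) with M uᵢ = M vᵢ.
  InToricIdeal : ∀ {B : Set} {d m} → Matrix B d m
               → (Matrix B d m → Vec ℕ m → Fin d → B) → Pol m → Set (c ⊔ ℓ)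
  InToricIdeal {m = m} M mul f =
    Σ (List (Pol m × Vec ℕ m × Vec ℕ m)) λ gs →
      All (λ { (g , u , v) → ∀ i → mul M u i ≡ mul M v i }) gs ×
      (f ≈P sumP (List.map (λ { (g , u , v) → g *P binom u v }) gs))

  InToricIdealℤ : ∀ {d m} → Matrix ℤ d m → Pol m → Set (c ⊔ ℓ)
  InToricIdealℤ M = InToricIdeal M mulVecℤ

  InToricIdealℚ : ∀ {d m} → Matrix ℚ d m → Pol m → Set (c ⊔ ℓ)
  InToricIdealℚ M = InToricIdeal M mulVecℚ

  -- φ : K[x_1..x_{n+1}] → K[x_1..x_n], x_{n+1} ↦ 1, x_i ↦ x_i
  φ : ∀ {n} → Pol (suc n) → Pol n
  φ = List.map (λ { (a , e) → (a , init e) })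

module Submission where

-- Proposition: for A = (B | a) ∈ ℤ^{d×(n+1)} with primitive last column a, and
-- A′ = first n columns of P_a A, the toric ideal I_A′ is the image of I_A under
-- φ : xₙ₊₁ ↦ 1.  Membership in a toric ideal is witnessed by generators
-- g (x^u - x^v) with u, v in a common fibre, so the statement reduces to a
-- correspondence between fibres:
--   * A′ (init u) = P_a (A u), because A′ = P_a B and P_a a = 0; hence fibres of
--     A map to fibres of A′ under dropping the last exponent;
--   * conversely A′ u = A′ v says P_a (B u - B v) = 0, i.e. ‖a‖² (B u - B v) =
--     (a · (B u - B v)) a, and primitivity of a makes B u - B v = q a with q ∈ ℤ;
--     choosing last exponents (0, q) or (-q, 0) lifts u, v to a fibre of A.
-- Since φ is a ring homomorphism with section "append exponent 0", generators
-- are transported in both directions.  Everything works over an arbitrary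
-- commutative ring of coefficients.

open import Defs
open import Algebra.Bundles using (CommutativeRing)
open import Data.Nat using (ℕ; suc)
open import Data.Integer using (ℤ)
open import Data.Fin using (fromℕ)
open import Data.Product using (∃; _×_)
open import Function.Bundles using (_⇔_)

open import Algebra.Bundles using (CommutativeMonoid; Semiring)
open import Data.Nat as ℕ using (zero; s≤s; z≤n)
import Data.Nat.Properties as ℕP
open import Data.Nat.Divisibility as ℕ∣ using (divides)
open import Data.Nat.DivMod using (_/_; m/n*n≡m)
open import Data.Nat.GCD using (gcd; gcd[m,n]∣m; gcd[m,n]∣n; gcd[m,n]≢0)
open import Data.Nat.Coprimality using (1-coprimeTo; coprime-/gcd; coprime-divisor)
import Data.Nat.Coprimality as Coprimality
open import Data.Integer as ℤ using (+_; -[1+_]; ∣_∣)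
import Data.Integer.Properties as ℤP
import Data.Integer.Divisibility.Signed as ℤ∣
open import Data.Integer.Solver using () renaming (module +-*-Solver to ℤ-Solver)
open import Data.Rational as ℚ using (ℚ; mkℚ; 0ℚ; 1ℚ)
import Data.Rational.Properties as ℚP
open import Algebra.Properties.Group ℚP.+-0-group using (x∙y⁻¹≈ε⇒x≈y)
open import Data.Rational.Base using (≢-nonZero)
open import Data.Rational.Solver using () renaming (module +-*-Solver to ℚ-Solver)
open import Data.Fin using (Fin; zero; suc; inject₁; fromℕ<; toℕ; punchIn; _≟_)
open import Data.Fin.Properties using (punchInᵢ≢i; toℕ-fromℕ<; toℕ-injective)
open import Data.Vec as Vec using (Vec; []; _∷_; lookup; init; last; zipWith; _∷ʳ_; tabulate)
open import Data.Vec.Properties using (init-∷ʳ; ∷ʳ-injectiveʳ; ≡-dec)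
import Data.Vec.Functional as Vector
open import Data.List as List using (List; []; _∷_; _++_)
open import Data.List.Properties using (map-++; ++-identityʳ)
open import Data.List.Relation.Unary.All using (All; []; _∷_)
open import Data.Product using (Σ; ∃₂; _,_; proj₁; proj₂)
open import Data.Sum using (inj₁; inj₂)
open import Function using (_∘_)
open import Function.Bundles using (mk⇔)
open import Relation.Nullary using (¬_; yes; no; contradiction)
open import Relation.Binary.PropositionalEquality using (_≡_; _≢_; refl; sym; trans; cong; cong₂; subst; module ≡-Reasoning)

module CommutativeMonoidSums {c ℓ} (M : CommutativeMonoid c ℓ) where
  open CommutativeMonoid M using (Carrier; _≈_; setoid)
    renaming (_∙_ to _+_; ε to 0#; ∙-congˡ to +-congˡ; identityʳ to +-identityʳ; trans to ≈-trans)
  open import Algebra.Properties.CommutativeMonoid.Sum M using (sum; sum-cong-≋; sum-replicate-zero; sum-remove)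

  sum-zero : ∀ {n} {f : Fin n → Carrier} → (∀ i → f i ≈ 0#) → sum f ≈ 0#
  sum-zero {n} f≈0 = ≈-trans (sum-cong-≋ f≈0) (sum-replicate-zero n)

  sum-single : ∀ {n} {f : Fin n → Carrier} (k : Fin n) → (∀ i → i ≢ k → f i ≈ 0#) → sum f ≈ f k
  sum-single {suc n} {f} k vanish = begin
    sum f                                ≈⟨ sum-remove {i = k} f ⟩
    f k + sum (λ j → f (punchIn k j))     ≈⟨ +-congˡ (sum-zero (λ j → vanish (punchIn k j) (punchInᵢ≢i k j))) ⟩
    f k + 0#                             ≈⟨ +-identityʳ (f k) ⟩
    f k                                  ∎
    where open import Relation.Binary.Reasoning.Setoid setoid

module SemiringSums {c ℓ} (R : Semiring c ℓ) where
  open Semiring R using (+-commutativeMonoid)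
  open import Algebra.Properties.Semiring.Sum R public
  open CommutativeMonoidSums +-commutativeMonoid public using (sum-zero; sum-single)

module ΣN = SemiringSums ℕP.+-*-semiring
module ΣZ = SemiringSums ℤP.+-*-semiring
module ΣQ = SemiringSums (CommutativeRing.semiring ℚP.+-*-commutativeRing)

foldr-tabulate : ∀ {A : Set} (_∙_ : A → A → A) (ε : A) {n} (f : Fin n → A) →
                 Vec.foldr (λ _ → A) _∙_ ε (tabulate f) ≡ Vector.foldr _∙_ ε f
foldr-tabulate _∙_ ε {zero}  f = refl
foldr-tabulate _∙_ ε {suc n} f = cong (f zero ∙_) (foldr-tabulate _∙_ ε (f ∘ suc))

sumℚ≡sum : ∀ {n} (f : Fin n → ℚ) → sumℚ f ≡ ΣQ.sum f
sumℚ≡sum = foldr-tabulate ℚ._+_ ℚ.0ℚ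

sumℤ≡sum : ∀ {n} (f : Fin n → ℤ) → sumℤ f ≡ ΣZ.sum f
sumℤ≡sum = foldr-tabulate ℤ._+_ (+ 0)

-- The embedding ℤ → ℚ is an injective ring homomorphism; it is computed by
-- exhibiting ℤ→ℚ z as the already normalised fraction z / 1.
ℤ→ℚ-mkℚ : ∀ z → ℤ→ℚ z ≡ mkℚ z 0 (Coprimality.sym (1-coprimeTo ∣ z ∣))
ℤ→ℚ-mkℚ z = ℚP.↥p/↧p≡p (mkℚ z 0 (Coprimality.sym (1-coprimeTo ∣ z ∣)))

ℤ→ℚ-+ : ∀ x y → ℤ→ℚ (x ℤ.+ y) ≡ ℤ→ℚ x ℚ.+ ℤ→ℚ y
ℤ→ℚ-+ x y rewrite ℤ→ℚ-mkℚ x | ℤ→ℚ-mkℚ y | ℤP.*-identityʳ x | ℤP.*-identityʳ y = refl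

ℤ→ℚ-* : ∀ x y → ℤ→ℚ (x ℤ.* y) ≡ ℤ→ℚ x ℚ.* ℤ→ℚ y
ℤ→ℚ-* x y rewrite ℤ→ℚ-mkℚ x | ℤ→ℚ-mkℚ y = refl

ℤ→ℚ-injective : ∀ {x y} → ℤ→ℚ x ≡ ℤ→ℚ y → x ≡ y
ℤ→ℚ-injective {x} {y} eq rewrite ℤ→ℚ-mkℚ x | ℤ→ℚ-mkℚ y = cong ℚ.↥_ eq

ℤ→ℚ-sum : ∀ {n} (f : Fin n → ℤ) → ℤ→ℚ (ΣZ.sum f) ≡ ΣQ.sum (ℤ→ℚ ∘ f)
ℤ→ℚ-sum {zero}  f = refl
ℤ→ℚ-sum {suc n} f = trans (ℤ→ℚ-+ (f zero) _) (cong (ℤ→ℚ (f zero) ℚ.+_) (ℤ→ℚ-sum (f ∘ suc)))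

dot : ∀ {d} → (Fin d → ℤ) → (Fin d → ℤ) → ℤ
dot x y = ΣZ.sum (λ k → x k ℤ.* y k)

ℤ→ℚ-dot : ∀ {d} (x y : Fin d → ℤ) → ℤ→ℚ (dot x y) ≡ ΣQ.sum (λ k → ℤ→ℚ (x k) ℚ.* ℤ→ℚ (y k))
ℤ→ℚ-dot {d} x y = trans (ℤ→ℚ-sum {d} _) (ΣQ.sum-cong-≗ (λ k → ℤ→ℚ-* (x k) (y k)))

normSq≡dot : ∀ {d} (x : Fin d → ℤ) → normSq x ≡ ℤ→ℚ (dot x x)
normSq≡dot {d} x = trans (sumℚ≡sum {d} _) (sym (ℤ→ℚ-dot x x))

dot-self : ∀ {d} (x : Fin d → ℤ) → dot x x ≡ + ΣN.sum (λ k → ∣ x k ∣ ℕ.* ∣ x k ∣)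
dot-self {zero}  x = refl
dot-self {suc d} x = trans (cong₂ ℤ._+_ (square (x zero)) (dot-self (x ∘ suc))) (sym (ℤP.pos-+ (∣ x zero ∣ ℕ.* ∣ x zero ∣) _))
  where
  square : ∀ i → i ℤ.* i ≡ + (∣ i ∣ ℕ.* ∣ i ∣)
  square (+ m)    = ℤP.+◃n≡+n (m ℕ.* m)
  square -[1+ m ] = ℤP.+◃n≡+n (suc m ℕ.* suc m)

sum≡0⇒terms≡0 : ∀ {d} (f : Fin d → ℕ) → ΣN.sum f ≡ 0 → ∀ k → f k ≡ 0
sum≡0⇒terms≡0 f eq zero    = ℕP.m+n≡0⇒m≡0 (f zero) eq
sum≡0⇒terms≡0 f eq (suc k) = sum≡0⇒terms≡0 (f ∘ suc) (ℕP.m+n≡0⇒n≡0 (f zero) eq) k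

primitive⇒dot-self≢0 : ∀ {d} (x : Fin d → ℤ) → NoCommonDivisor x → dot x x ≢ + 0
primitive⇒dot-self≢0 x ncd x·x≡0 =
  ncd 2 (s≤s (s≤s z≤n)) (λ k → subst (λ t → 2 ℕ∣.∣ ∣ t ∣) (sym (x≡0 k)) (2 ℕ∣.∣0))
  where
  x≡0 : ∀ k → x k ≡ + 0
  x≡0 k with ℕP.m*n≡0⇒m≡0∨n≡0 ∣ x k ∣
               (sum≡0⇒terms≡0 _ (ℤP.+-injective (trans (sym (dot-self x)) x·x≡0)) k)
  ... | inj₁ |xₖ|≡0 = ℤP.∣i∣≡0⇒i≡0 |xₖ|≡0
  ... | inj₂ |xₖ|≡0 = ℤP.∣i∣≡0⇒i≡0 |xₖ|≡0

-- If Zᵢ N = Xᵢ S for all i, with N ≠ 0 and the Xᵢ without common divisor > 1,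
-- then N ∣ S: the reduced denominator N / gcd(N,S) divides every Xᵢ, hence is 1.
primitive-scaling : ∀ {d} (X Z : Fin d → ℕ) {N S : ℕ} → N ≢ 0 →
                    (∀ k → 1 ℕ.< k → ¬ (∀ i → k ℕ∣.∣ X i)) →
                    (∀ i → Z i ℕ.* N ≡ X i ℕ.* S) → N ℕ∣.∣ S
primitive-scaling X Z {N} {S} N≢0 ncd eq = subst (ℕ∣._∣ S) g≡N (gcd[m,n]∣n N S)
  where
  g : ℕ
  g = gcd N S
  instance
    g≢0 : ℕ.NonZero g
    g≢0 = ℕ.≢-nonZero (gcd[m,n]≢0 N S (inj₁ N≢0))
  N′ S′ : ℕ
  N′ = N / g
  S′ = S / g
  N′g≡N : N′ ℕ.* g ≡ N
  N′g≡N = m/n*n≡m (gcd[m,n]∣m N S)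
  S′g≡S : S′ ℕ.* g ≡ S
  S′g≡S = m/n*n≡m (gcd[m,n]∣n N S)
  reduced : ∀ i → Z i ℕ.* N′ ≡ S′ ℕ.* X i
  reduced i = ℕP.*-cancelʳ-≡ _ _ g (begin
    Z i ℕ.* N′ ℕ.* g   ≡⟨ ℕP.*-assoc (Z i) N′ g ⟩
    Z i ℕ.* (N′ ℕ.* g) ≡⟨ cong (Z i ℕ.*_) N′g≡N ⟩
    Z i ℕ.* N          ≡⟨ eq i ⟩
    X i ℕ.* S          ≡⟨ cong (X i ℕ.*_) (sym S′g≡S) ⟩
    X i ℕ.* (S′ ℕ.* g) ≡⟨ sym (ℕP.*-assoc (X i) S′ g) ⟩
    X i ℕ.* S′ ℕ.* g   ≡⟨ cong (ℕ._* g) (ℕP.*-comm (X i) S′) ⟩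
    S′ ℕ.* X i ℕ.* g   ∎)
    where open ≡-Reasoning
  N′∣X : ∀ i → N′ ℕ∣.∣ X i
  N′∣X i = coprime-divisor (coprime-/gcd N S) (divides (Z i) (sym (reduced i)))
  N′≡1 : N′ ≡ 1
  N′≡1 with ℕP.n≤1⇒n≡0∨n≡1 (ℕP.≮⇒≥ (λ 1<N′ → ncd N′ 1<N′ N′∣X))
  ... | inj₂ N′≡1 = N′≡1
  ... | inj₁ N′≡0 = contradiction (trans (sym N′g≡N) (cong (ℕ._* g) N′≡0)) N≢0
  g≡N : g ≡ N
  g≡N = trans (sym (ℕP.*-identityˡ g)) (trans (cong (ℕ._* g) (sym N′≡1)) N′g≡N)

primitive-multiple : ∀ {d} (x z : Fin d → ℤ) {N s : ℤ} → NoCommonDivisor x → N ≢ + 0 →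
                     (∀ i → z i ℤ.* N ≡ x i ℤ.* s) → ∃ λ q → ∀ i → z i ≡ q ℤ.* x i
primitive-multiple x z {N} {s} ncd N≢0 eq = q , λ i →
  ℤP.*-cancelʳ-≡ (z i) (q ℤ.* x i) N {{ℤ.≢-nonZero N≢0}} (begin
    z i ℤ.* N         ≡⟨ eq i ⟩
    x i ℤ.* s         ≡⟨ cong (x i ℤ.*_) (ℤ∣._∣_.equality N∣s) ⟩
    x i ℤ.* (q ℤ.* N) ≡⟨ sym (ℤP.*-assoc (x i) q N) ⟩
    x i ℤ.* q ℤ.* N   ≡⟨ cong (ℤ._* N) (ℤP.*-comm (x i) q) ⟩
    q ℤ.* x i ℤ.* N   ∎)
  where
  open ≡-Reasoning
  |eq| : ∀ i → ∣ z i ∣ ℕ.* ∣ N ∣ ≡ ∣ x i ∣ ℕ.* ∣ s ∣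
  |eq| i = trans (sym (ℤP.abs-* (z i) N)) (trans (cong ∣_∣ (eq i)) (ℤP.abs-* (x i) s))
  N∣s : N ℤ∣.∣ s
  N∣s = ℤ∣.∣ᵤ⇒∣ (primitive-scaling (∣_∣ ∘ x) (∣_∣ ∘ z) (N≢0 ∘ ℤP.∣i∣≡0⇒i≡0) ncd |eq|)
  q : ℤ
  q = ℤ∣._∣_.quotient N∣s

project : ∀ {d} → (Fin d → ℤ) → (Fin d → ℤ) → Fin d → ℚ
project a x i = ΣQ.sum (λ k → P a i k ℚ.* ℤ→ℚ (x k))

project-cong : ∀ {d} (a : Fin d → ℤ) {x y : Fin d → ℤ} → (∀ k → x k ≡ y k) → ∀ i → project a x i ≡ project a y i
project-cong a x≡y i = ΣQ.sum-cong-≗ (λ k → cong (λ t → P a i k ℚ.* ℤ→ℚ t) (x≡y k))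

project-linear : ∀ {d} (a x y : Fin d → ℤ) (c : ℤ) (i : Fin d) →
                 project a (λ k → x k ℤ.+ y k ℤ.* c) i ≡ project a x i ℚ.+ project a y i ℚ.* ℤ→ℚ c
project-linear {d} a x y c i = begin
  ΣQ.sum (λ k → P a i k ℚ.* ℤ→ℚ (x k ℤ.+ y k ℤ.* c))
    ≡⟨ ΣQ.sum-cong-≗ (λ k → expand (P a i k) (x k) (y k)) ⟩
  ΣQ.sum (λ k → P a i k ℚ.* ℤ→ℚ (x k) ℚ.+ P a i k ℚ.* ℤ→ℚ (y k) ℚ.* ℤ→ℚ c)
    ≡⟨ ΣQ.∑-distrib-+ {d} _ _ ⟩
  project a x i ℚ.+ ΣQ.sum (λ k → P a i k ℚ.* ℤ→ℚ (y k) ℚ.* ℤ→ℚ c)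
    ≡⟨ cong (project a x i ℚ.+_) (sym (ΣQ.*-distribʳ-sum {d} (ℤ→ℚ c) _)) ⟩
  project a x i ℚ.+ project a y i ℚ.* ℤ→ℚ c ∎
  where
  open ≡-Reasoning
  open ℚ-Solver
  distrib : ∀ p q r s → p ℚ.* (q ℚ.+ r ℚ.* s) ≡ p ℚ.* q ℚ.+ p ℚ.* r ℚ.* s
  distrib = solve 4 (λ p q r s → p :* (q :+ r :* s) := p :* q :+ p :* r :* s) refl
  expand : ∀ p u v → p ℚ.* ℤ→ℚ (u ℤ.+ v ℤ.* c) ≡ p ℚ.* ℤ→ℚ u ℚ.+ p ℚ.* ℤ→ℚ v ℚ.* ℤ→ℚ c
  expand p u v = trans (cong (p ℚ.*_) (trans (ℤ→ℚ-+ u _) (cong (ℤ→ℚ u ℚ.+_) (ℤ→ℚ-* v c))))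
                       (distrib p (ℤ→ℚ u) (ℤ→ℚ v) (ℤ→ℚ c))

δ-sum : ∀ {d} (i : Fin d) (y : Fin d → ℚ) → ΣQ.sum (λ k → δ i k ℚ.* y k) ≡ y i
δ-sum i y = trans (ΣQ.sum-single i off-diagonal) on-diagonal
  where
  off-diagonal : ∀ k → k ≢ i → δ i k ℚ.* y k ≡ 0ℚ
  off-diagonal k k≢i with i ≟ k
  ... | yes i≡k = contradiction (sym i≡k) k≢i
  ... | no  _   = ℚP.*-zeroˡ (y k)
  on-diagonal : δ i i ℚ.* y i ≡ y i
  on-diagonal with i ≟ i
  ... | yes _   = ℚP.*-identityˡ (y i)
  ... | no  i≢i = contradiction refl i≢i

module Projection {d} (a : Fin d → ℤ) (‖a‖²≢0 : normSq a ≢ 0ℚ) where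
  instance
    ‖a‖²-nonZero : ℚ.NonZero (normSq a)
    ‖a‖²-nonZero = ≢-nonZero ‖a‖²≢0

  r : ℚ
  r = ℚ.1/ normSq a

  P-entry : ∀ i k → P a i k ≡ δ i k ℚ.- ℤ→ℚ (a i) ℚ.* ℤ→ℚ (a k) ℚ.* r
  P-entry i k with normSq a ℚ.≟ 0ℚ
  ... | yes ‖a‖²≡0 = contradiction ‖a‖²≡0 ‖a‖²≢0
  ... | no  _      = refl

  project-formula : ∀ x i → project a x i ≡ ℤ→ℚ (x i) ℚ.- ℤ→ℚ (a i) ℚ.* r ℚ.* ℤ→ℚ (dot a x)
  project-formula x i = begin
    ΣQ.sum (λ k → P a i k ℚ.* ℤ→ℚ (x k))
      ≡⟨ ΣQ.sum-cong-≗ (λ k → trans (cong (ℚ._* ℤ→ℚ (x k)) (P-entry i k)) (split (δ i k) (ℤ→ℚ (a i)) (ℤ→ℚ (a k)) (ℤ→ℚ (x k)))) ⟩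
    ΣQ.sum (λ k → δ i k ℚ.* ℤ→ℚ (x k) ℚ.+ c ℚ.* (ℤ→ℚ (a k) ℚ.* ℤ→ℚ (x k)))
      ≡⟨ ΣQ.∑-distrib-+ {d} _ _ ⟩
    ΣQ.sum (λ k → δ i k ℚ.* ℤ→ℚ (x k)) ℚ.+ ΣQ.sum (λ k → c ℚ.* (ℤ→ℚ (a k) ℚ.* ℤ→ℚ (x k)))
      ≡⟨ cong₂ ℚ._+_ (δ-sum i _) (sym (ΣQ.*-distribˡ-sum {d} c _)) ⟩
    ℤ→ℚ (x i) ℚ.+ c ℚ.* ΣQ.sum (λ k → ℤ→ℚ (a k) ℚ.* ℤ→ℚ (x k))
      ≡⟨ cong (λ t → ℤ→ℚ (x i) ℚ.+ c ℚ.* t) (sym (ℤ→ℚ-dot a x)) ⟩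
    ℤ→ℚ (x i) ℚ.+ c ℚ.* ℤ→ℚ (dot a x)
      ≡⟨ collect (ℤ→ℚ (x i)) (ℤ→ℚ (a i)) r (ℤ→ℚ (dot a x)) ⟩
    ℤ→ℚ (x i) ℚ.- ℤ→ℚ (a i) ℚ.* r ℚ.* ℤ→ℚ (dot a x) ∎
    where
    open ≡-Reasoning
    open ℚ-Solver
    c : ℚ
    c = ℚ.- (ℤ→ℚ (a i) ℚ.* r)
    split : ∀ D α β t → (D ℚ.- α ℚ.* β ℚ.* r) ℚ.* t ≡ D ℚ.* t ℚ.+ ℚ.- (α ℚ.* r) ℚ.* (β ℚ.* t)
    split D α β t = solve 5 (λ D α β ρ t → (D :- α :* β :* ρ) :* t := D :* t :+ (:- (α :* ρ)) :* (β :* t)) refl D α β r t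
    collect : ∀ y α ρ s → y ℚ.+ ℚ.- (α ℚ.* ρ) ℚ.* s ≡ y ℚ.- α ℚ.* ρ ℚ.* s
    collect = solve 4 (λ y α ρ s → y :+ (:- (α :* ρ)) :* s := y :- α :* ρ :* s) refl

  r*‖a‖²≡1 : r ℚ.* ℤ→ℚ (dot a a) ≡ 1ℚ
  r*‖a‖²≡1 = trans (cong (r ℚ.*_) (sym (normSq≡dot a))) (ℚP.*-inverseˡ (normSq a))

  project-self : ∀ i → project a a i ≡ 0ℚ
  project-self i = begin
    project a a i                                    ≡⟨ project-formula a i ⟩
    αᵢ ℚ.- αᵢ ℚ.* r ℚ.* ℤ→ℚ (dot a a)                 ≡⟨ cong (λ t → αᵢ ℚ.- t) (ℚP.*-assoc αᵢ r _) ⟩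
    αᵢ ℚ.- αᵢ ℚ.* (r ℚ.* ℤ→ℚ (dot a a))               ≡⟨ cong (λ t → αᵢ ℚ.- αᵢ ℚ.* t) r*‖a‖²≡1 ⟩
    αᵢ ℚ.- αᵢ ℚ.* 1ℚ                                 ≡⟨ cong (λ t → αᵢ ℚ.- t) (ℚP.*-identityʳ αᵢ) ⟩
    αᵢ ℚ.- αᵢ                                        ≡⟨ ℚP.+-inverseʳ αᵢ ⟩
    0ℚ                                               ∎
    where
    open ≡-Reasoning
    αᵢ : ℚ
    αᵢ = ℤ→ℚ (a i)

  project-kernel : ∀ z → (∀ i → project a z i ≡ 0ℚ) → ∀ i → z i ℤ.* dot a a ≡ a i ℤ.* dot a z
  project-kernel z Pz≡0 i = ℤ→ℚ-injective (begin
    ℤ→ℚ (z i ℤ.* dot a a)                    ≡⟨ ℤ→ℚ-* (z i) _ ⟩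
    ℤ→ℚ (z i) ℚ.* N                          ≡⟨ cong (ℚ._* N) zᵢ≡ ⟩
    ℤ→ℚ (a i) ℚ.* r ℚ.* D ℚ.* N              ≡⟨ regroup (ℤ→ℚ (a i)) r D N ⟩
    ℤ→ℚ (a i) ℚ.* D ℚ.* (r ℚ.* N)            ≡⟨ cong (ℤ→ℚ (a i) ℚ.* D ℚ.*_) r*‖a‖²≡1 ⟩
    ℤ→ℚ (a i) ℚ.* D ℚ.* 1ℚ                   ≡⟨ ℚP.*-identityʳ _ ⟩
    ℤ→ℚ (a i) ℚ.* D                          ≡⟨ sym (ℤ→ℚ-* (a i) (dot a z)) ⟩
    ℤ→ℚ (a i ℤ.* dot a z)                    ∎)
    where
    open ≡-Reasoning
    open ℚ-Solver
    N D : ℚ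
    N = ℤ→ℚ (dot a a)
    D = ℤ→ℚ (dot a z)
    zᵢ≡ : ℤ→ℚ (z i) ≡ ℤ→ℚ (a i) ℚ.* r ℚ.* D
    zᵢ≡ = x∙y⁻¹≈ε⇒x≈y _ _ (trans (sym (project-formula z i)) (Pz≡0 i))
    regroup : ∀ p q x y → p ℚ.* q ℚ.* x ℚ.* y ≡ p ℚ.* x ℚ.* (q ℚ.* y)
    regroup = solve 4 (λ p q x y → p :* q :* x :* y := p :* x :* (q :* y)) refl

lookup-∷ʳ-inject₁ : ∀ {n} (u : Vec ℕ n) m (j : Fin n) → lookup (u ∷ʳ m) (inject₁ j) ≡ lookup u j
lookup-∷ʳ-inject₁ (x ∷ u) m zero    = refl
lookup-∷ʳ-inject₁ (x ∷ u) m (suc j) = lookup-∷ʳ-inject₁ u m j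

lookup-∷ʳ-last : ∀ {n} (u : Vec ℕ n) m → lookup (u ∷ʳ m) (fromℕ n) ≡ m
lookup-∷ʳ-last []      m = refl
lookup-∷ʳ-last (x ∷ u) m = lookup-∷ʳ-last u m

init-∷ʳ-last : ∀ {n} (u : Vec ℕ (suc n)) → u ≡ init u ∷ʳ last u
init-∷ʳ-last u = proj₂ (proj₂ (Vec.initLast u))

init-zipWith : ∀ {n} (e f : Vec ℕ (suc n)) → init (zipWith ℕ._+_ e f) ≡ zipWith ℕ._+_ (init e) (init f)
init-zipWith {zero}  (x ∷ [])    (y ∷ [])    = refl
init-zipWith {suc n} (x ∷ e@(_ ∷ _)) (y ∷ f@(_ ∷ _)) = cong (x ℕ.+ y ∷_) (init-zipWith e f)

module Columns {d n : ℕ} (A : Matrix ℤ d (suc n)) where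
  a : Fin d → ℤ
  a = col A (fromℕ n)

  front : Vec ℕ n → Fin d → ℤ
  front u k = ΣZ.sum (λ j → A k (inject₁ j) ℤ.* + lookup u j)

  mulVec-∷ʳ : ∀ (u : Vec ℕ n) m k → mulVecℤ A (u ∷ʳ m) k ≡ front u k ℤ.+ a k ℤ.* + m
  mulVec-∷ʳ u m k = begin
    mulVecℤ A (u ∷ʳ m) k
      ≡⟨ sumℤ≡sum {suc n} (λ j → A k j ℤ.* + lookup (u ∷ʳ m) j) ⟩
    ΣZ.sum (λ j → A k j ℤ.* + lookup (u ∷ʳ m) j)
      ≡⟨ ΣZ.sum-init-last {n} (λ j → A k j ℤ.* + lookup (u ∷ʳ m) j) ⟩
    ΣZ.sum (λ j → A k (inject₁ j) ℤ.* + lookup (u ∷ʳ m) (inject₁ j)) ℤ.+ a k ℤ.* + lookup (u ∷ʳ m) (fromℕ n)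
      ≡⟨ cong₂ ℤ._+_ (ΣZ.sum-cong-≗ {n} (λ j → cong (λ t → A k (inject₁ j) ℤ.* + t) (lookup-∷ʳ-inject₁ u m j)))
                     (cong (λ t → a k ℤ.* + t) (lookup-∷ʳ-last u m)) ⟩
    front u k ℤ.+ a k ℤ.* + m ∎
    where open ≡-Reasoning

  A′-mulVec : ∀ (u : Vec ℕ n) i → mulVecℚ (A′ A) u i ≡ project a (front u) i
  A′-mulVec u i = begin
    mulVecℚ (A′ A) u i
      ≡⟨ trans (sumℚ≡sum {n} _) (ΣQ.sum-cong-≗ {n} (λ j → cong (ℚ._* uⱼ j) (sumℚ≡sum {d} _))) ⟩
    ΣQ.sum (λ j → ΣQ.sum (λ k → P a i k ℚ.* Aₖⱼ k j) ℚ.* uⱼ j)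
      ≡⟨ ΣQ.sum-cong-≗ {n} (λ j → ΣQ.*-distribʳ-sum {d} (uⱼ j) _) ⟩
    ΣQ.sum (λ j → ΣQ.sum (λ k → P a i k ℚ.* Aₖⱼ k j ℚ.* uⱼ j))
      ≡⟨ ΣQ.∑-comm {n} {d} _ ⟩
    ΣQ.sum (λ k → ΣQ.sum (λ j → P a i k ℚ.* Aₖⱼ k j ℚ.* uⱼ j))
      ≡⟨ ΣQ.sum-cong-≗ {d} (λ k → trans (ΣQ.sum-cong-≗ {n} (λ j → ℚP.*-assoc (P a i k) _ _))
                                        (sym (ΣQ.*-distribˡ-sum {n} (P a i k) _))) ⟩
    ΣQ.sum (λ k → P a i k ℚ.* ΣQ.sum (λ j → Aₖⱼ k j ℚ.* uⱼ j))
      ≡⟨ ΣQ.sum-cong-≗ {d} (λ k → cong (P a i k ℚ.*_) (sym (front-cast k))) ⟩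
    project a (front u) i ∎
    where
    open ≡-Reasoning
    Aₖⱼ : Fin d → Fin n → ℚ
    Aₖⱼ k j = ℤ→ℚ (A k (inject₁ j))
    uⱼ : Fin n → ℚ
    uⱼ j = ℕ→ℚ (lookup u j)
    front-cast : ∀ k → ℤ→ℚ (front u k) ≡ ΣQ.sum (λ j → Aₖⱼ k j ℚ.* uⱼ j)
    front-cast k = trans (ℤ→ℚ-sum {n} _) (ΣQ.sum-cong-≗ {n} (λ j → ℤ→ℚ-* (A k (inject₁ j)) _))

  balance : ∀ (u v : Vec ℕ n) q → (∀ i → front u i ≡ front v i ℤ.+ q ℤ.* a i) →
            ∃₂ λ k k′ → ∀ i → mulVecℤ A (u ∷ʳ k) i ≡ mulVecℤ A (v ∷ʳ k′) i
  balance u v (+ m) Bu≡ = 0 , m , λ i → begin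
    mulVecℤ A (u ∷ʳ 0) i        ≡⟨ mulVec-∷ʳ u 0 i ⟩
    front u i ℤ.+ a i ℤ.* + 0   ≡⟨ cong (ℤ._+ a i ℤ.* + 0) (Bu≡ i) ⟩
    front v i ℤ.+ + m ℤ.* a i ℤ.+ a i ℤ.* + 0
      ≡⟨ solve 3 (λ x c y → x :+ c :* y :+ y :* con (+ 0) := x :+ y :* c) refl (front v i) (+ m) (a i) ⟩
    front v i ℤ.+ a i ℤ.* + m   ≡⟨ sym (mulVec-∷ʳ v m i) ⟩
    mulVecℤ A (v ∷ʳ m) i        ∎
    where
    open ≡-Reasoning
    open ℤ-Solver
  balance u v -[1+ m ] Bu≡ = suc m , 0 , λ i → begin
    mulVecℤ A (u ∷ʳ suc m) i          ≡⟨ mulVec-∷ʳ u (suc m) i ⟩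
    front u i ℤ.+ a i ℤ.* + suc m     ≡⟨ cong (ℤ._+ a i ℤ.* + suc m) (Bu≡ i) ⟩
    front v i ℤ.+ ℤ.- (+ suc m) ℤ.* a i ℤ.+ a i ℤ.* + suc m
      ≡⟨ solve 3 (λ x c y → x :+ (:- c) :* y :+ y :* c := x :+ y :* con (+ 0)) refl (front v i) (+ suc m) (a i) ⟩
    front v i ℤ.+ a i ℤ.* + 0         ≡⟨ sym (mulVec-∷ʳ v 0 i) ⟩
    mulVecℤ A (v ∷ʳ 0) i              ∎
    where
    open ≡-Reasoning
    open ℤ-Solver

  module Fibres (ncd : NoCommonDivisor a) where
    N≢0 : dot a a ≢ + 0
    N≢0 = primitive⇒dot-self≢0 a ncd

    open Projection a (λ ‖a‖²≡0 → N≢0 (ℤ→ℚ-injective (trans (sym (normSq≡dot a)) ‖a‖²≡0)))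

    -- A′ (init u) = P_a (A u), since P_a kills the last column.
    A′-init : ∀ (u : Vec ℕ (suc n)) i → mulVecℚ (A′ A) (init u) i ≡ project a (mulVecℤ A u) i
    A′-init u i = begin
      mulVecℚ (A′ A) (init u) i                               ≡⟨ A′-mulVec (init u) i ⟩
      project a (front (init u)) i                           ≡⟨ sym (ℚP.+-identityʳ _) ⟩
      project a (front (init u)) i ℚ.+ 0ℚ                     ≡⟨ cong (project a (front (init u)) i ℚ.+_)
                                                                   (sym (trans (cong (ℚ._* ℤ→ℚ (+ last u)) (project-self i)) (ℚP.*-zeroˡ (ℤ→ℚ (+ last u))))) ⟩
      project a (front (init u)) i ℚ.+ project a a i ℚ.* ℤ→ℚ (+ last u)
                                                              ≡⟨ sym (project-linear a (front (init u)) a (+ last u) i) ⟩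
      project a (λ k → front (init u) k ℤ.+ a k ℤ.* + last u) i ≡⟨ project-cong a (λ k → sym (mulVec-∷ʳ (init u) (last u) k)) i ⟩
      project a (mulVecℤ A (init u ∷ʳ last u)) i              ≡⟨ cong (λ w → project a (mulVecℤ A w) i) (sym (init-∷ʳ-last u)) ⟩
      project a (mulVecℤ A u) i                               ∎
      where open ≡-Reasoning

    fibre-down : ∀ (u v : Vec ℕ (suc n)) → (∀ i → mulVecℤ A u i ≡ mulVecℤ A v i) →
                 ∀ i → mulVecℚ (A′ A) (init u) i ≡ mulVecℚ (A′ A) (init v) i
    fibre-down u v Au≡Av i = trans (A′-init u i) (trans (project-cong a Au≡Av i) (sym (A′-init v i)))

    -- A′ u = A′ v means P_a (B u - B v) = 0, so B u - B v is a rational, hence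
    -- (a being primitive) an integer multiple of a.
    fibre-up : ∀ (u v : Vec ℕ n) → (∀ i → mulVecℚ (A′ A) u i ≡ mulVecℚ (A′ A) v i) →
               ∃₂ λ k k′ → ∀ i → mulVecℤ A (u ∷ʳ k) i ≡ mulVecℤ A (v ∷ʳ k′) i
    fibre-up u v A′u≡A′v = balance u v q Bu≡
      where
      z : Fin d → ℤ
      z k = front u k ℤ.+ front v k ℤ.* ℤ.-1ℤ
      Pz≡0 : ∀ i → project a z i ≡ 0ℚ
      Pz≡0 i = begin
        project a z i
          ≡⟨ project-linear a (front u) (front v) ℤ.-1ℤ i ⟩
        project a (front u) i ℚ.+ project a (front v) i ℚ.* ℤ→ℚ ℤ.-1ℤ
          ≡⟨ cong (λ t → t ℚ.+ project a (front v) i ℚ.* ℤ→ℚ ℤ.-1ℤ)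
                  (trans (sym (A′-mulVec u i)) (trans (A′u≡A′v i) (A′-mulVec v i))) ⟩
        project a (front v) i ℚ.+ project a (front v) i ℚ.* ℚ.- ℚ.1ℚ
          ≡⟨ solve 1 (λ x → x :+ x :* (:- con ℚ.1ℚ) := con 0ℚ) refl (project a (front v) i) ⟩
        0ℚ ∎
        where
        open ≡-Reasoning
        open ℚ-Solver
      multiple : ∃ λ q → ∀ i → z i ≡ q ℤ.* a i
      multiple = primitive-multiple a z ncd N≢0 (project-kernel z Pz≡0)
      q : ℤ
      q = proj₁ multiple
      Bu≡ : ∀ i → front u i ≡ front v i ℤ.+ q ℤ.* a i
      Bu≡ i = begin
        front u i                      ≡⟨ solve 2 (λ x y → x := y :+ (x :+ y :* con ℤ.-1ℤ)) refl (front u i) (front v i) ⟩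
        front v i ℤ.+ z i              ≡⟨ cong (λ t → front v i ℤ.+ t) (proj₂ multiple i) ⟩
        front v i ℤ.+ q ℤ.* a i        ∎
        where
        open ≡-Reasoning
        open ℤ-Solver

module Substitution {c ℓ} (K : CommutativeRing c ℓ) where
  open CommutativeRing K renaming (refl to ≈-refl; sym to ≈-sym; trans to ≈-trans)
  open Poly K
  module ΣK = SemiringSums semiring

  φ-+ : ∀ {n} (p q : Pol (suc n)) → φ (p +P q) ≡ φ p +P φ q
  φ-+ p q = map-++ _ p q

  *P-∷ : ∀ {m} (t : Term m) (p q : Pol m) → (t ∷ p) *P q ≡ ((t ∷ []) *P q) +P (p *P q)
  *P-∷ t p q = cong (_++ (p *P q)) (sym (++-identityʳ _))

  φ-*-term : ∀ {n} a (e : Vec ℕ (suc n)) q → φ (((a , e) ∷ []) *P q) ≡ ((a , init e) ∷ []) *P φ q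
  φ-*-term a e []            = refl
  φ-*-term a e ((b , f) ∷ q) = cong₂ _∷_ (cong (a * b ,_) (init-zipWith e f)) (φ-*-term a e q)

  φ-* : ∀ {n} (p q : Pol (suc n)) → φ (p *P q) ≡ φ p *P φ q
  φ-* []            q = refl
  φ-* ((a , e) ∷ p) q = begin
    φ (((a , e) ∷ p) *P q)                            ≡⟨ cong φ (*P-∷ (a , e) p q) ⟩
    φ ((((a , e) ∷ []) *P q) +P (p *P q))             ≡⟨ φ-+ (((a , e) ∷ []) *P q) _ ⟩
    φ (((a , e) ∷ []) *P q) +P φ (p *P q)             ≡⟨ cong₂ _+P_ (φ-*-term a e q) (φ-* p q) ⟩
    (((a , init e) ∷ []) *P φ q) +P (φ p *P φ q)      ≡⟨ sym (*P-∷ (a , init e) (φ p) (φ q)) ⟩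
    ((a , init e) ∷ φ p) *P φ q                       ∎
    where open ≡-Reasoning

  lift : ∀ {n} → Pol n → Pol (suc n)
  lift = List.map (λ t → (proj₁ t , proj₂ t ∷ʳ 0))

  φ-lift : ∀ {n} (p : Pol n) → φ (lift p) ≡ p
  φ-lift []            = refl
  φ-lift ((a , e) ∷ p) = cong₂ _∷_ (cong (a ,_) (init-∷ʳ 0 e)) (φ-lift p)

  termCoeff : ∀ {m} → Vec ℕ m → Vec ℕ m → Carrier → Carrier
  termCoeff e′ e a with ≡-dec ℕ._≟_ e′ e
  ... | yes _ = a
  ... | no  _ = 0#

  coeff-∷ : ∀ {m} a (e′ : Vec ℕ m) p e → coeff ((a , e′) ∷ p) e ≈ termCoeff e′ e a + coeff p e
  coeff-∷ a e′ p e with ≡-dec ℕ._≟_ e′ e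
  ... | yes _ = ≈-refl
  ... | no  _ = ≈-sym (+-identityˡ _)

  termCoeff-≡ : ∀ {m} {e′ e : Vec ℕ m} a → e′ ≡ e → termCoeff e′ e a ≈ a
  termCoeff-≡ {e′ = e′} {e} a e′≡e with ≡-dec ℕ._≟_ e′ e
  ... | yes _    = ≈-refl
  ... | no  e′≢e = contradiction e′≡e e′≢e

  termCoeff-≢ : ∀ {m} {e′ e : Vec ℕ m} a → e′ ≢ e → termCoeff e′ e a ≈ 0#
  termCoeff-≢ {e′ = e′} {e} a e′≢e with ≡-dec ℕ._≟_ e′ e
  ... | yes e′≡e = contradiction e′≡e e′≢e
  ... | no  _    = ≈-refl

  -- Setting xₙ₊₁ = 1 in a x^e′ contributes to x^e exactly through the monomials
  -- x^e xₙ₊₁^k; when last e′ < N it suffices to let k range below N.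
  termCoeff-init : ∀ {n} N (e′ : Vec ℕ (suc n)) (e : Vec ℕ n) a → last e′ ℕ.< N →
                   termCoeff (init e′) e a ≈ ΣK.sum {N} (λ k → termCoeff e′ (e ∷ʳ toℕ k) a)
  termCoeff-init N e′ e a last<N with ≡-dec ℕ._≟_ (init e′) e
  ... | yes init≡e = ≈-sym (≈-trans (ΣK.sum-single {N} kₑ off-kₑ) (termCoeff-≡ a e′≡))
    where
    kₑ : Fin N
    kₑ = fromℕ< last<N
    e′≡ : e′ ≡ e ∷ʳ toℕ kₑ
    e′≡ = trans (init-∷ʳ-last e′) (cong₂ _∷ʳ_ init≡e (sym (toℕ-fromℕ< last<N)))
    off-kₑ : ∀ k → k ≢ kₑ → termCoeff e′ (e ∷ʳ toℕ k) a ≈ 0#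
    off-kₑ k k≢kₑ = termCoeff-≢ a (λ e′≡ekₖ → k≢kₑ (toℕ-injective (∷ʳ-injectiveʳ e e (trans (sym e′≡ekₖ) e′≡))))
  ... | no init≢e = ≈-sym (ΣK.sum-zero {N} (λ k → termCoeff-≢ a (λ e′≡ → init≢e (trans (cong init e′≡) (init-∷ʳ (toℕ k) e)))))

  Bounded : ∀ {n} → ℕ → Pol (suc n) → Set c
  Bounded N p = All (λ t → last (proj₂ t) ℕ.< N) p

  coeff-φ : ∀ {n} N (p : Pol (suc n)) (e : Vec ℕ n) → Bounded N p →
            coeff (φ p) e ≈ ΣK.sum {N} (λ k → coeff p (e ∷ʳ toℕ k))
  coeff-φ N []             e []                = ≈-sym (ΣK.sum-zero {N} (λ k → ≈-refl))
  coeff-φ N ((a , e′) ∷ p) e (last<N ∷ bounded) = begin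
    coeff ((a , init e′) ∷ φ p) e
      ≈⟨ coeff-∷ a (init e′) (φ p) e ⟩
    termCoeff (init e′) e a + coeff (φ p) e
      ≈⟨ +-cong (termCoeff-init N e′ e a last<N) (coeff-φ N p e bounded) ⟩
    ΣK.sum {N} (λ k → termCoeff e′ (e ∷ʳ toℕ k) a) + ΣK.sum {N} (λ k → coeff p (e ∷ʳ toℕ k))
      ≈⟨ ΣK.∑-distrib-+ {N} _ _ ⟨
    ΣK.sum {N} (λ k → termCoeff e′ (e ∷ʳ toℕ k) a + coeff p (e ∷ʳ toℕ k))
      ≈⟨ ΣK.sum-cong-≋ {N} (λ k → coeff-∷ a e′ p (e ∷ʳ toℕ k)) ⟨
    ΣK.sum {N} (λ k → coeff ((a , e′) ∷ p) (e ∷ʳ toℕ k)) ∎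
    where open import Relation.Binary.Reasoning.Setoid setoid

  lastExponentSum : ∀ {n} → Pol (suc n) → ℕ
  lastExponentSum []            = 0
  lastExponentSum ((a , e) ∷ p) = last e ℕ.+ lastExponentSum p

  bounded : ∀ {n} (p : Pol (suc n)) M → lastExponentSum p ℕ.≤ M → Bounded (suc M) p
  bounded []            M _ = []
  bounded ((a , e) ∷ p) M ≤M =
    ℕ.s≤s (ℕP.≤-trans (ℕP.m≤m+n (last e) (lastExponentSum p)) ≤M) ∷
    bounded p M (ℕP.≤-trans (ℕP.m≤n+m (lastExponentSum p) (last e)) ≤M)

  φ-cong : ∀ {n} (p q : Pol (suc n)) → p ≈P q → φ p ≈P φ q
  φ-cong p q p≈q e = begin
    coeff (φ p) e                          ≈⟨ coeff-φ N p e (bounded p M (ℕP.m≤m+n _ _)) ⟩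
    ΣK.sum {N} (λ k → coeff p (e ∷ʳ toℕ k)) ≈⟨ ΣK.sum-cong-≋ {N} (λ k → p≈q (e ∷ʳ toℕ k)) ⟩
    ΣK.sum {N} (λ k → coeff q (e ∷ʳ toℕ k)) ≈⟨ coeff-φ N q e (bounded q M (ℕP.m≤n+m _ _)) ⟨
    coeff (φ q) e                          ∎
    where
    open import Relation.Binary.Reasoning.Setoid setoid
    M N : ℕ
    M = lastExponentSum p ℕ.+ lastExponentSum q
    N = suc M

module ToricCorrespondence {c ℓ} (K : CommutativeRing c ℓ) {d n : ℕ} (A : Matrix ℤ d (suc n))
                           (ncd : NoCommonDivisor (col A (fromℕ n))) where
  open CommutativeRing K renaming (refl to ≈-refl; sym to ≈-sym; trans to ≈-trans)
  open Poly K
  open Substitution K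
  open Columns A
  open Fibres ncd

  Generators : ℕ → Set c
  Generators m = List (Pol m × Vec ℕ m × Vec ℕ m)

  -- The polynomial g (x^u - x^v) of a generator, and the sum over a list of them;
  -- the latter is definitionally the sum appearing in the toric-ideal predicate.
  term : ∀ {m} → Pol m × Vec ℕ m × Vec ℕ m → Pol m
  term (g , u , v) = g *P binom u v

  combine : ∀ {m} → Generators m → Pol m
  combine gs = sumP (List.map term gs)

  FibreA : Pol (suc n) × Vec ℕ (suc n) × Vec ℕ (suc n) → Set
  FibreA (_ , u , v) = ∀ i → mulVecℤ A u i ≡ mulVecℤ A v i

  FibreA′ : Pol n × Vec ℕ n × Vec ℕ n → Set
  FibreA′ (_ , u , v) = ∀ i → mulVecℚ (A′ A) u i ≡ mulVecℚ (A′ A) v i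

  lower-one : ∀ t → FibreA t → Σ (Pol n × Vec ℕ n × Vec ℕ n) λ h → FibreA′ h × φ (term t) ≡ term h
  lower-one (g , u , v) Au≡Av = (φ g , init u , init v) , fibre-down u v Au≡Av , φ-* g (binom u v)

  raise-one : ∀ t → FibreA′ t → Σ (Pol (suc n) × Vec ℕ (suc n) × Vec ℕ (suc n)) λ h → FibreA h × φ (term h) ≡ term t
  raise-one (g , u , v) A′u≡A′v =
    let (k , k′ , Au≡Av) = fibre-up u v A′u≡A′v in
    (lift g , u ∷ʳ k , v ∷ʳ k′) , Au≡Av ,
    trans (φ-* (lift g) (binom (u ∷ʳ k) (v ∷ʳ k′)))
          (cong₂ _*P_ (φ-lift g) (cong₂ binom (init-∷ʳ k u) (init-∷ʳ k′ v)))

  lower : ∀ gs → All FibreA gs → Σ (Generators n) λ hs → All FibreA′ hs × φ (combine gs) ≡ combine hs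
  lower []       []       = [] , [] , refl
  lower (t ∷ gs) (f ∷ fs) =
    let (h , fh , φt≡) = lower-one t f
        (hs , fhs , φgs≡) = lower gs fs
    in h ∷ hs , fh ∷ fhs , trans (φ-+ (term t) (combine gs)) (cong₂ List._++_ φt≡ φgs≡)

  raise : ∀ gs → All FibreA′ gs → Σ (Generators (suc n)) λ hs → All FibreA hs × φ (combine hs) ≡ combine gs
  raise []       []       = [] , [] , refl
  raise (t ∷ gs) (f ∷ fs) =
    let (h , fh , φh≡) = raise-one t f
        (hs , fhs , φhs≡) = raise gs fs
    in h ∷ hs , fh ∷ fhs , trans (φ-+ (term h) (combine hs)) (cong₂ List._++_ φh≡ φhs≡)

  toric-up : ∀ g → InToricIdealℚ (A′ A) g → ∃ λ f → InToricIdealℤ A f × φ f ≈P g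
  toric-up g (gs , fibres , g≈) =
    let (hs , fibres′ , φ≡) = raise gs fibres in
    combine hs , (hs , fibres′ , λ e → ≈-refl) , λ e → ≈-trans (reflexive (cong (λ p → coeff p e) φ≡)) (≈-sym (g≈ e))

  toric-down : ∀ g → (∃ λ f → InToricIdealℤ A f × φ f ≈P g) → InToricIdealℚ (A′ A) g
  toric-down g (f , (gs , fibres , f≈) , φf≈g) =
    let (hs , fibres′ , φ≡) = lower gs fibres in
    hs , fibres′ , λ e → ≈-trans (≈-sym (φf≈g e)) (≈-trans (φ-cong f (combine gs) f≈ e) (reflexive (cong (λ p → coeff p e) φ≡)))

proposition6p6 : ∀ {c ℓ} (K : CommutativeRing c ℓ) → IsField K →
    (d n : ℕ) (A : Matrix ℤ d (suc n)) →
    NoCommonDivisor (col A (fromℕ n)) →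
    let open Poly K in
    ∀ (g : Pol n) → InToricIdealℚ (A′ A) g ⇔ (∃ λ f → InToricIdealℤ A f × φ f ≈P g)
proposition6p6 K _ d n A ncd g = mk⇔ (toric-up g) (toric-down g)
  where open ToricCorrespondence K A ncd
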